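{- Let $V=\{1,\dots,n\}$, let $f:2^V\to\mathbb{R}$ be submodular with $f(\emptyset)=0$, and let $X\subseteq V$. Define $\tilde g_X\in\mathbb{R}^n$ by $\tilde g_X(j)=f(j\mid X\setminus\{j\})$ if $j\in X$ and $\tilde g_X(j)=f(j\mid X)$ if $j\notin X$. Then for every $Y\subseteq V$ with $Y\subseteq X$ or $Y\supseteq X$, $f(Y)\le f(X)-\tilde g_X(X)+\tilde g_X(Y).$
   Context: For $g\in\mathbb{R}^n$ and $S\subseteq V$, $g(S)=\sum_{i\in S}g(i)$. $f(j\mid S)=f(S\cup\{j\})-f(S)$. $f$ is submodular if $f(S)+f(T)\ge f(S\cup T)+f(S\cap T)$ for all $S,T\subseteq V$. -}

module Defs where

open import Level using (Level; _⊔_; suc)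
open import Data.Bool using (Bool; true; false; if_then_else_)
open import Data.Nat using (ℕ)
open import Data.Fin using (Fin)
open import Data.Vec using (lookup)
open import Data.Fin.Subset using (Subset; _∪_; _∩_; _─_; ⁅_⁆)
open import Algebra.Bundles using (AbelianGroup)
open import Relation.Binary.Core using (Rel)
open import Relation.Binary.Structures using (IsTotalOrder)

-- A totally ordered abelian group (ℝ with + and ≤ is an instance).
-- The order is translation invariant: a ≤ b implies a + c ≤ b + c.
record OrderedAbelianGroup (c ℓ₁ ℓ₂ : Level) : Set (suc (c ⊔ ℓ₁ ⊔ ℓ₂)) where
  field
    abelianGroup : AbelianGroup c ℓ₁
  open AbelianGroup abelianGroup public
  infix 4 _≤_
  field
    _≤_          : Rel Carrier ℓ₂
    isTotalOrder : IsTotalOrder _≈_ _≤_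
    ∙-monoˡ-≤    : ∀ {a b} (x : Carrier) → a ≤ b → (a ∙ x) ≤ (b ∙ x)

module _ {c ℓ₁ ℓ₂ : Level} (G : OrderedAbelianGroup c ℓ₁ ℓ₂) where
  open OrderedAbelianGroup G

  _⊖_ : Carrier → Carrier → Carrier
  a ⊖ b = a ∙ (b ⁻¹)

  sumFin : {n : ℕ} → (Fin n → Carrier) → Carrier
  sumFin {ℕ.zero}  h = ε
  sumFin {ℕ.suc n} h = h Fin.zero ∙ sumFin (λ i → h (Fin.suc i))

  modular : {n : ℕ} → (Fin n → Carrier) → Subset n → Carrier
  modular g S = sumFin (λ i → if lookup S i then g i else ε)

  marginal : {n : ℕ} → (Subset n → Carrier) → Fin n → Subset n → Carrier
  marginal f j S = f (S ∪ ⁅ j ⁆) ⊖ f S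

  Submodular : {n : ℕ} → (Subset n → Carrier) → Set ℓ₂
  Submodular f = ∀ S T → (f (S ∪ T) ∙ f (S ∩ T)) ≤ (f S ∙ f T)

  gTilde : {n : ℕ} → (Subset n → Carrier) → Subset n → Fin n → Carrier
  gTilde f X j = if lookup X j then marginal f j (X ─ ⁅ j ⁆) else marginal f j X

module Submission where

-- Write g = g̃_X.  The claim  f(Y) ≤ f(X) - g(X) + g(Y)
-- says that the "gap"  f(S) - g(S)  is at least as large at S = X as at any
-- Y comparable with X.  We prove this by induction on n, splitting off the
-- first element 0 of V.  Fixing whether 0 lies in a set turns f into a
-- submodular function on n elements, and the coordinates 1..n of g̃_X are
-- exactly the coordinates of g̃ for that restriction; the coordinate 0 is
-- the marginal gain  m = f(X ∪ {0}) - f(X ∖ {0}).  When X and Y agree on 0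
-- the step just subtracts the same amount from both gaps.  When they differ
-- (0 ∈ X ∖ Y for Y ⊆ X, or 0 ∈ Y ∖ X for X ⊆ Y) the step is paid for by the
-- diminishing-returns form of submodularity: the marginal gain of 0 is
-- smaller relative to the larger of the two sets.

open import Defs
open import Level using (Level)
open import Data.Bool using (Bool; true; false)
open import Data.Nat using (ℕ; suc)
open import Data.Fin as Fin using ()
open import Data.Sum using (_⊎_; inj₁; inj₂)
open import Data.Vec using ([]; _∷_; here)
open import Data.Fin.Subset using (Subset; ⊥; _⊆_; _⊇_; _∪_; _∩_; _─_)
open import Data.Fin.Subset.Properties using (drop-∷-⊆; p─⊥≡p; ∪-identityʳ)
open import Relation.Binary.PropositionalEquality as ≡ using (_≡_; cong; subst₂)
open import Relation.Binary.Bundles using (Poset)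
open import Relation.Binary.Structures using (IsTotalOrder)
import Relation.Binary.Reasoning.PartialOrder as PartialOrderReasoning
import Algebra.Properties.AbelianGroup as AbelianGroupProperties

p⊆q⇒p∪q≡q : ∀ {n} {p q : Subset n} → p ⊆ q → p ∪ q ≡ q
p⊆q⇒p∪q≡q {p = []}        {[]}        _   = ≡.refl
p⊆q⇒p∪q≡q {p = true ∷ p}  {true ∷ q}  p⊆q = cong (true ∷_) (p⊆q⇒p∪q≡q (drop-∷-⊆ p⊆q))
p⊆q⇒p∪q≡q {p = true ∷ p}  {false ∷ q} p⊆q with () ← p⊆q here
p⊆q⇒p∪q≡q {p = false ∷ p} {b ∷ q}     p⊆q = cong (b ∷_) (p⊆q⇒p∪q≡q (drop-∷-⊆ p⊆q))

p⊆q⇒p∩q≡p : ∀ {n} {p q : Subset n} → p ⊆ q → p ∩ q ≡ p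
p⊆q⇒p∩q≡p {p = []}        {[]}        _   = ≡.refl
p⊆q⇒p∩q≡p {p = true ∷ p}  {true ∷ q}  p⊆q = cong (true ∷_) (p⊆q⇒p∩q≡p (drop-∷-⊆ p⊆q))
p⊆q⇒p∩q≡p {p = true ∷ p}  {false ∷ q} p⊆q with () ← p⊆q here
p⊆q⇒p∩q≡p {p = false ∷ p} {b ∷ q}     p⊆q = cong (false ∷_) (p⊆q⇒p∩q≡p (drop-∷-⊆ p⊆q))

-- Differences in an ordered abelian group: how  a - b  interacts with ∙ and ≤.
-- (The group's  a - b = a ∙ b ⁻¹  is definitionally the  a ⊖ b  of Defs.)

module DifferenceCalculus {c ℓ₁ ℓ₂ : Level} (G : OrderedAbelianGroup c ℓ₁ ℓ₂) where
  open OrderedAbelianGroup G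
  open AbelianGroupProperties abelianGroup using (⁻¹-anti-homo-∙)
  open IsTotalOrder isTotalOrder using (isPartialOrder)

  poset : Poset c ℓ₁ ℓ₂
  poset = record { isPartialOrder = isPartialOrder }

  open PartialOrderReasoning poset

  -‿monoˡ-≤ : ∀ {a b} z → a ≤ b → a - z ≤ b - z
  -‿monoˡ-≤ z = ∙-monoˡ-≤ (z ⁻¹)

  ∙-swapʳ : ∀ x y z → (x ∙ y) ∙ z ≈ (x ∙ z) ∙ y
  ∙-swapʳ x y z = trans (assoc x y z) (trans (∙-congˡ (comm y z)) (sym (assoc x z y)))

  -∙-cancel : ∀ x y → (x - y) ∙ y ≈ x
  -∙-cancel x y = trans (assoc x (y ⁻¹) y) (trans (∙-congˡ (inverseˡ y)) (identityʳ x))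

  ∙--cancel : ∀ x y → (x ∙ y) - y ≈ x
  ∙--cancel x y = trans (assoc x y (y ⁻¹)) (trans (∙-congˡ (inverseʳ y)) (identityʳ x))

  -‿∙ : ∀ x y z → x - (y ∙ z) ≈ (x - z) - y
  -‿∙ x y z = trans (∙-congˡ (⁻¹-anti-homo-∙ y z)) (sym (assoc x (z ⁻¹) (y ⁻¹)))

  -‿swap : ∀ x y z → (x - y) - z ≈ (x - z) - y
  -‿swap x y z = ∙-swapʳ x (y ⁻¹) (z ⁻¹)

  ≤∙⇒-≤ : ∀ {a b c} → a ≤ b ∙ c → a - c ≤ b
  ≤∙⇒-≤ {a} {b} {c} a≤bc = begin
    a - c         ≤⟨ -‿monoˡ-≤ c a≤bc ⟩
    (b ∙ c) - c   ≈⟨ ∙--cancel b c ⟩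
    b             ∎

  -≤⇒≤∙ : ∀ {a b c} → a - b ≤ c → a ≤ c ∙ b
  -≤⇒≤∙ {a} {b} {c} a-b≤c = begin
    a             ≈⟨ -∙-cancel a b ⟨
    (a - b) ∙ b   ≤⟨ ∙-monoˡ-≤ b a-b≤c ⟩
    c ∙ b         ∎

  ∙≤⇒≤- : ∀ {a b c} → a ∙ b ≤ c → a ≤ c - b
  ∙≤⇒≤- {a} {b} {c} ab≤c = begin
    a             ≈⟨ ∙--cancel a b ⟨
    (a ∙ b) - b   ≤⟨ -‿monoˡ-≤ b ab≤c ⟩
    c - b         ∎

  -≤-exchange : ∀ {a b c} → a - b ≤ c → a - c ≤ b
  -≤-exchange {a} {b} {c} a-b≤c = ≤∙⇒-≤ (begin
    a       ≤⟨ -≤⇒≤∙ a-b≤c ⟩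
    c ∙ b   ≈⟨ comm c b ⟩
    b ∙ c   ∎)

  ≤--exchange : ∀ {a b c} → c ≤ a - b → b ≤ a - c
  ≤--exchange {a} {b} {c} c≤a-b = ∙≤⇒≤- (begin
    b ∙ c         ≈⟨ comm b c ⟩
    c ∙ b         ≤⟨ ∙-monoˡ-≤ b c≤a-b ⟩
    (a - b) ∙ b   ≈⟨ -∙-cancel a b ⟩
    a             ∎)

  cross⇒-≤- : ∀ {a b c d} → a ∙ d ≤ c ∙ b → a - b ≤ c - d
  cross⇒-≤- {a} {b} {c} {d} ad≤cb = ∙≤⇒≤- (begin
    (a - b) ∙ d   ≈⟨ ∙-swapʳ a (b ⁻¹) d ⟩
    (a ∙ d) - b   ≤⟨ -‿monoˡ-≤ b ad≤cb ⟩
    (c ∙ b) - b   ≈⟨ ∙--cancel c b ⟩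
    c             ∎)

module FirstElement {c ℓ₁ ℓ₂ : Level} (G : OrderedAbelianGroup c ℓ₁ ℓ₂) where
  open OrderedAbelianGroup G
  open DifferenceCalculus G using (cross⇒-≤-)

  restrict-submodular : ∀ {n} (b : Bool) (f : Subset (suc n) → Carrier) →
    Submodular G f → Submodular G (λ S → f (b ∷ S))
  restrict-submodular true  f sm S T = sm (true ∷ S) (true ∷ T)
  restrict-submodular false f sm S T = sm (false ∷ S) (false ∷ T)

  -- Diminishing returns: the marginal gain of the first element relative to
  -- the rest of the set decreases as the set grows.  This is submodularity
  -- applied to {0} ∪ Y and X.
  first-marginal-antitone : ∀ {n} (f : Subset (suc n) → Carrier) → Submodular G f →
    {X Y : Subset n} → Y ⊆ X → f (true ∷ X) - f (false ∷ X) ≤ f (true ∷ Y) - f (false ∷ Y)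
  first-marginal-antitone f sm {X} {Y} Y⊆X = cross⇒-≤- (subst₂
    (λ U V → f (true ∷ U) ∙ f (false ∷ V) ≤ f (true ∷ Y) ∙ f (false ∷ X))
    (p⊆q⇒p∪q≡q Y⊆X) (p⊆q⇒p∩q≡p Y⊆X)
    (sm (true ∷ Y) (false ∷ X)))

  gTilde-first : ∀ {n} (f : Subset (suc n) → Carrier) (b : Bool) (X : Subset n) →
    gTilde G f (b ∷ X) Fin.zero ≈ f (true ∷ X) - f (false ∷ X)
  gTilde-first f true  X = ∙-cong
    (reflexive (cong (λ S → f (true ∷ S)) X─⊥∪⊥≡X))
    (⁻¹-cong (reflexive (cong (λ S → f (false ∷ S)) (p─⊥≡p X))))
    where
      X─⊥∪⊥≡X : (X ─ ⊥) ∪ ⊥ ≡ X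
      X─⊥∪⊥≡X = ≡.trans (∪-identityʳ (X ─ ⊥)) (p─⊥≡p X)
  gTilde-first f false X = ∙-congʳ (reflexive (cong (λ S → f (true ∷ S)) (∪-identityʳ X)))

module GapAtX {c ℓ₁ ℓ₂ : Level} (G : OrderedAbelianGroup c ℓ₁ ℓ₂) where
  open OrderedAbelianGroup G
  open IsTotalOrder isTotalOrder using (≤-respˡ-≈; ≤-respʳ-≈) renaming (refl to ≤-refl)
  open DifferenceCalculus G
  open FirstElement G
  open PartialOrderReasoning poset

  GapBound : ∀ {n} → (Subset n → Carrier) → Subset n → Subset n → Set ℓ₂
  GapBound f X Y = f Y - modular G (gTilde G f X) Y ≤ f X - modular G (gTilde G f X) X

  -- The three shapes of the inductive step.  In each, A and B are the values
  -- of the modular part on the remaining n elements for Y and for X.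

  -- X and Y agree on the first element, whose weight h is subtracted from both gaps.
  step-same-first : ∀ {a A b B} h → a - A ≤ b - B → a - (h ∙ A) ≤ b - (h ∙ B)
  step-same-first {a} {A} {b} {B} h gap≤ = begin
    a - (h ∙ A)   ≈⟨ -‿∙ a h A ⟩
    (a - A) - h   ≤⟨ -‿monoˡ-≤ h gap≤ ⟩
    (b - B) - h   ≈⟨ -‿∙ b h B ⟨
    b - (h ∙ B)   ∎

  -- Y ⊆ X with 0 ∈ X ∖ Y: the gap of Y is compared with that of {0} ∪ Y
  -- (value r), using diminishing returns  m ≤ r - a  for the weight m = p - q of 0.
  step-first-only-in-X : ∀ {a A p B q r m} → m ≈ p - q → p - q ≤ r - a → r - A ≤ p - B →
    a - (ε ∙ A) ≤ p - (m ∙ B)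
  step-first-only-in-X {a} {A} {p} {B} {q} {r} {m} m≈p-q marginal≤ gap≤ = begin
    a - (ε ∙ A)   ≈⟨ ∙-congˡ (⁻¹-cong (identityˡ A)) ⟩
    a - A         ≤⟨ -‿monoˡ-≤ A (≤--exchange (≤-respˡ-≈ (sym m≈p-q) marginal≤)) ⟩
    (r - m) - A   ≈⟨ -‿swap r m A ⟩
    (r - A) - m   ≤⟨ -‿monoˡ-≤ m gap≤ ⟩
    (p - B) - m   ≈⟨ -‿∙ p m B ⟨
    p - (m ∙ B)   ∎

  -- X ⊆ Y with 0 ∈ Y ∖ X: the gap of Y is compared with that of Y ∖ {0}
  -- (value t), using diminishing returns  s - t ≤ m.
  step-first-only-in-Y : ∀ {s A q B p t m} → m ≈ p - q → s - t ≤ p - q → t - A ≤ q - B →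
    s - (m ∙ A) ≤ q - (ε ∙ B)
  step-first-only-in-Y {s} {A} {q} {B} {p} {t} {m} m≈p-q marginal≤ gap≤ = begin
    s - (m ∙ A)   ≈⟨ -‿∙ s m A ⟩
    (s - A) - m   ≈⟨ -‿swap s A m ⟩
    (s - m) - A   ≤⟨ -‿monoˡ-≤ A (-≤-exchange (≤-respʳ-≈ (sym m≈p-q) marginal≤)) ⟩
    t - A         ≤⟨ gap≤ ⟩
    q - B         ≈⟨ ∙-congˡ (⁻¹-cong (identityˡ B)) ⟨
    q - (ε ∙ B)   ∎

  -- Induction on the ground set for Y ⊆ X.  In every case the induction
  -- hypothesis is taken for the restriction fixing the first element as in X,
  -- so that its g̃ is the tail of g̃_X.
  gap-bound-below : ∀ {n} (f : Subset n → Carrier) → Submodular G f →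
    (X Y : Subset n) → Y ⊆ X → GapBound f X Y
  gap-bound-below f sm []          []          _   = ≤-refl
  gap-bound-below f sm (true ∷ X)  (true ∷ Y)  Y⊆X = step-same-first _
    (gap-bound-below (λ S → f (true ∷ S)) (restrict-submodular true f sm) X Y (drop-∷-⊆ Y⊆X))
  gap-bound-below f sm (false ∷ X) (false ∷ Y) Y⊆X = step-same-first _
    (gap-bound-below (λ S → f (false ∷ S)) (restrict-submodular false f sm) X Y (drop-∷-⊆ Y⊆X))
  gap-bound-below f sm (false ∷ X) (true ∷ Y)  Y⊆X with () ← Y⊆X here
  gap-bound-below f sm (true ∷ X)  (false ∷ Y) Y⊆X = step-first-only-in-X
    (gTilde-first f true X)
    (first-marginal-antitone f sm (drop-∷-⊆ Y⊆X))
    (gap-bound-below (λ S → f (true ∷ S)) (restrict-submodular true f sm) X Y (drop-∷-⊆ Y⊆X))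

  -- Induction on the ground set for X ⊆ Y, again restricting as in X.
  gap-bound-above : ∀ {n} (f : Subset n → Carrier) → Submodular G f →
    (X Y : Subset n) → X ⊆ Y → GapBound f X Y
  gap-bound-above f sm []          []          _   = ≤-refl
  gap-bound-above f sm (true ∷ X)  (true ∷ Y)  X⊆Y = step-same-first _
    (gap-bound-above (λ S → f (true ∷ S)) (restrict-submodular true f sm) X Y (drop-∷-⊆ X⊆Y))
  gap-bound-above f sm (false ∷ X) (false ∷ Y) X⊆Y = step-same-first _
    (gap-bound-above (λ S → f (false ∷ S)) (restrict-submodular false f sm) X Y (drop-∷-⊆ X⊆Y))
  gap-bound-above f sm (true ∷ X)  (false ∷ Y) X⊆Y with () ← X⊆Y here
  gap-bound-above f sm (false ∷ X) (true ∷ Y)  X⊆Y = step-first-only-in-Y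
    (gTilde-first f false X)
    (first-marginal-antitone f sm (drop-∷-⊆ X⊆Y))
    (gap-bound-above (λ S → f (false ∷ S)) (restrict-submodular false f sm) X Y (drop-∷-⊆ X⊆Y))

  gap-bound : ∀ {n} (f : Subset n → Carrier) → Submodular G f →
    (X Y : Subset n) → Y ⊆ X ⊎ Y ⊇ X → GapBound f X Y
  gap-bound f sm X Y (inj₁ Y⊆X) = gap-bound-below f sm X Y Y⊆X
  gap-bound f sm X Y (inj₂ X⊆Y) = gap-bound-above f sm X Y X⊆Y

-- Theorem 9.  Rearranging the gap bound  f(Y) - g̃_X(Y) ≤ f(X) - g̃_X(X)  gives
-- the claim.
mainTheorem9 : {c ℓ₁ ℓ₂ : Level} (G : OrderedAbelianGroup c ℓ₁ ℓ₂) →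
    let open OrderedAbelianGroup G in
    (n : ℕ) (f : Subset n → Carrier) →
    Submodular G f → f ⊥ ≈ ε →
    (X Y : Subset n) → (Y ⊆ X ⊎ Y ⊇ X) →
    f Y ≤ ((_⊖_ G (f X) (modular G (gTilde G f X) X)) ∙ modular G (gTilde G f X) Y)
mainTheorem9 G n f submodular _ X Y comparable =
  DifferenceCalculus.-≤⇒≤∙ G (GapAtX.gap-bound G f submodular X Y comparable)
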